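{- Let $L$ be an implicative lattice with a greatest element $1$, and let $y \in L$ with $y < 1$. Then the mapping $f_y : L \to L$, $f_y(x) = x \to y$, has no fixed point, i.e. there is no $x \in L$ with $x = x \to y$.
   Context: A lattice $L$ is called implicative (Brouwerian) if for any $a,b\in L$ the set $\{x\in L : a \wedge x \leqq b\}$ has a greatest element, denoted $a\to b$. -}

-- If x = x → y then x ∧ x ≤ y, so x ≤ y; then every z satisfies z ∧ x ≤ y,
-- i.e. z ≤ x → y = x ≤ y, so y is the greatest element.
module Submission where

open import Level using (Level)
open import Data.Product using (∃; _,_; proj₁; proj₂)
open import Relation.Nullary using (¬_)
open import Relation.Binary.Definitions using (Maximum)
open import Relation.Binary.Lattice.Definitions using (Exponential)
open import Relation.Binary.Lattice.Bundles using (MeetSemilattice; Lattice)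

module ExponentialProperties {c ℓ₁ ℓ₂ : Level} (M : MeetSemilattice c ℓ₁ ℓ₂)
  {_⇨_ : MeetSemilattice.Carrier M → MeetSemilattice.Carrier M → MeetSemilattice.Carrier M}
  (exponential : Exponential (MeetSemilattice._≤_ M) (MeetSemilattice._∧_ M) _⇨_)
  where

  open MeetSemilattice M

  ≤⇨-self⇒≤ : ∀ {x y} → x ≤ x ⇨ y → x ≤ y
  ≤⇨-self⇒≤ {x} {y} x≤x⇨y =
    trans (∧-greatest refl refl) (proj₂ (exponential x x y) x≤x⇨y)

  ≤⇒≤⇨ : ∀ {x y} z → x ≤ y → z ≤ x ⇨ y
  ≤⇒≤⇨ {x} {y} z x≤y = proj₁ (exponential z x y) (trans (x∧y≤y z x) x≤y)

  fixedPoint⇒≤ : ∀ {x y} z → x ≈ x ⇨ y → z ≤ y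
  fixedPoint⇒≤ z x≈x⇨y =
    trans (trans (≤⇒≤⇨ z x≤y) (reflexive (Eq.sym x≈x⇨y))) x≤y
    where x≤y = ≤⇨-self⇒≤ (reflexive x≈x⇨y)

mainTheorem11 : ∀ {c ℓ₁ ℓ₂ : Level} (L : Lattice c ℓ₁ ℓ₂)
    → let open Lattice L in
    (_⇨_ : Carrier → Carrier → Carrier)
    → Exponential _≤_ _∧_ _⇨_
    → (⊤ : Carrier) → Maximum _≤_ ⊤
    → (y : Carrier) → y ≤ ⊤ → ¬ (y ≈ ⊤)
    → ¬ (∃ λ x → x ≈ (x ⇨ y))
mainTheorem11 L _⇨_ exponential ⊤ _ y y≤⊤ y≉⊤ (_ , x≈x⇨y) =
  y≉⊤ (antisym y≤⊤ (fixedPoint⇒≤ ⊤ x≈x⇨y))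
  where
  open Lattice L using (antisym)
  open ExponentialProperties (Lattice.meetSemilattice L) exponential
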